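{- Let $H\in\mathscr{A}(\mathbf{n},G)$, and write $H=\{x_s-x_t=w\}$ for some $0\leq w\leq n_t+\varepsilon_G(t,s)$. Then for $i\in V^H\setminus\{u\}$, we have \begin{itemize} \item[(1)] $\max\{n_i-w+\varepsilon_{G}(i,s),\ n_i+\varepsilon_{G}(i,t)\}=n_i^H+\varepsilon_{G^H}(i,u)$, \item[(2)] $\max\{n_s+w+\varepsilon_{G}(s,i),\ n_t+\varepsilon_{G}(t,i)\}=n_u^H+\varepsilon_{G^H}(u,i)$, \item[(3)] $[-n_i+w-\varepsilon_{G}(i,s),n_s+w+\varepsilon_{G}(s,i)]\cup[-n_i-\varepsilon_{G}(i,t),n_t+\varepsilon_{G}(t,i)]=[-n_i^H-\varepsilon_{G^H}(i,u),n_u^H+\varepsilon_{G^H}(u,i)]$. \end{itemize}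
   Context: $\mathbb{K}$ is a field of characteristic zero, $V$ is a finite set with $|V|=\ell\geq 2$, $G=(V,E)$ is a digraph with $E\subseteq\{(i,j)\mid i,j\in V,\ i\neq j\}$, and $\mathbf{n}=(n_i)_{i\in V}\in\mathbb{Z}_{\geq 0}^V$. For $i\neq j$, $\varepsilon_G(i,j)=1$ if $(i,j)\in E$ and $0$ otherwise. The arrangement in $\mathbb{K}^V$ is $\mathscr{A}(\mathbf{n},G)=\{\{x_i-x_j=c\}\mid i,j\in V,\ i\neq j,\ c\in\mathbb{Z},\ -n_i-\varepsilon_G(i,j)\leq c\leq n_j+\varepsilon_G(j,i)\}$; equivalently every $H$ in it can be written $H=\{x_s-x_t=w\}$ with $0\leq w\leq n_t+\varepsilon_G(t,s)$. For such $H$, the contraction $G^H=(V^H,E^H)$ is defined by $V^H=(V\setminus\{s,t\})\cup\{u\}$ with $u$ a new vertex; for $i\in V^H\setminus\{u\}$: $(i,u)\in E^H$ iff $(i,t)\in E$ when $w>0$, and iff $(i,s)\in E$ or $(i,t)\in E$ when $w=0$; $(u,i)\in E^H$ iff $(s,i)\in E$ when $n_s+w>n_t$, iff $(s,i)\in E$ or $(t,i)\in E$ when $n_s+w=n_t$, and iff $(t,i)\in E$ when $n_s+w<n_t$; for $i,j\in V^H\setminus\{u\}$, $(i,j)\in E^H$ iff $(i,j)\in E$. Also $\mathbf{n}^H=(n^H_i)_{i\in V^H}$ with $n^H_i=n_i$ for $i\neq u$ and $n^H_u=\max\{n_s+w,n_t\}$. For integers $a\leq b$, $[a,b]=\{c\in\mathbb{Z}\mid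 a\leq c\leq b\}$. -}

module Defs where

open import Data.Bool using (Bool; true; false; if_then_else_; _∨_)
open import Data.Nat as ℕ using (ℕ; zero; suc)
open import Data.Nat.Properties using (<-cmp)
open import Data.Integer as ℤ using (ℤ; +_; _+_; _-_; -_; _≤_; _⊔_)
open import Data.Fin using (Fin)
open import Data.Product using (_×_)
open import Relation.Binary.PropositionalEquality using (_≡_; _≢_; refl)
open import Relation.Binary.Definitions using (tri<; tri≈; tri>)

record Digraph (V : Set) : Set where
  field
    edge     : V → V → Bool
    loopless : ∀ v → edge v v ≡ false
open Digraph public

ε : ∀ {V} → Digraph V → V → V → ℤ
ε G i j = if edge G i j then + 1 else + 0

data VH {ℓ : ℕ} (s t : Fin ℓ) : Set where
  u   : VH s t
  old : (i : Fin ℓ) → i ≢ s → i ≢ t → VH s t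

-- Edges of the contraction G^H (V = Fin ℓ, n : V → ℕ, H = {x_s - x_t = w}, w ≥ 0)
contractEdge : ∀ {ℓ} (G : Digraph (Fin ℓ)) (n : Fin ℓ → ℕ) (s t : Fin ℓ) (w : ℕ) →
               VH s t → VH s t → Bool
contractEdge G n s t w u u = false
contractEdge G n s t w (old i _ _) (old j _ _) = edge G i j
contractEdge G n s t w (old i _ _) u with w
... | zero  = edge G i s ∨ edge G i t
... | suc _ = edge G i t
contractEdge G n s t w u (old i _ _) with <-cmp (n s ℕ.+ w) (n t)
... | tri> _ _ _ = edge G s i
... | tri≈ _ _ _ = edge G s i ∨ edge G t i
... | tri< _ _ _ = edge G t i

contractLoopless : ∀ {ℓ} (G : Digraph (Fin ℓ)) (n : Fin ℓ → ℕ) (s t : Fin ℓ) (w : ℕ) →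
                   ∀ v → contractEdge G n s t w v v ≡ false
contractLoopless G n s t w u = refl
contractLoopless G n s t w (old i _ _) = loopless G i

contract : ∀ {ℓ} (G : Digraph (Fin ℓ)) (n : Fin ℓ → ℕ) (s t : Fin ℓ) (w : ℕ) →
           Digraph (VH s t)
contract G n s t w = record { edge = contractEdge G n s t w ; loopless = contractLoopless G n s t w }

contractN : ∀ {ℓ} (n : Fin ℓ → ℕ) (s t : Fin ℓ) (w : ℕ) → VH s t → ℕ
contractN n s t w u = ℕ._⊔_ (n s ℕ.+ w) (n t)
contractN n s t w (old i _ _) = n i

_∈[_,_] : ℤ → ℤ → ℤ → Set
c ∈[ a , b ] = (a ≤ c) × (c ≤ b)

-- Each side of (1) and (2) has the shape max(x + ε, y + ε') with ε, ε' ∈ {0, 1}. If x < y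
-- (or y < x) the larger base wins whatever the indicators are, and if x = y the maximum is
-- x + max(ε, ε'); these are exactly the three cases in the definition of the edges of G^H
-- at u (in (1), x < y unless w = 0). For (3), the hypothesis w ≤ n_t + ε(t,s) makes the two
-- intervals overlap or abut, so their union is the interval from the smaller lower endpoint
-- to the larger upper endpoint; by (1) and (2) these are the endpoints in G^H.
module Submission where

open import Defs
open import Data.Bool using (Bool; true; false; if_then_else_; _∨_)
open import Data.Nat as ℕ using (ℕ; _≥_)
import Data.Nat.Properties as ℕ
open import Data.Integer as ℤ
  using (ℤ; +_; _+_; _-_; -_; _⊔_; _⊓_; _<_; _≤_; _≤?_; pred; NonNegative; +≤+; +<+)
import Data.Integer.Properties as ℤ
open import Data.Fin using (Fin)
open import Data.Product using (_×_; _,_)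
open import Data.Sum using (_⊎_; inj₁; inj₂)
open import Function.Bundles using (_⇔_; mk⇔)
open import Relation.Binary.Definitions using (tri<; tri≈; tri>)
open import Relation.Binary.PropositionalEquality
  using (_≡_; _≢_; refl; sym; trans; cong; cong₂; subst₂; module ≡-Reasoning)
open import Relation.Nullary using (yes; no; contradiction)

-- ε G i j unfolds to 𝟙 (edge G i j), so the lemmas about 𝟙 apply to ε directly.
𝟙 : Bool → ℤ
𝟙 b = if b then + 1 else + 0

instance
  𝟙-nonNegative : ∀ {b} → NonNegative (𝟙 b)
  𝟙-nonNegative {false} = _
  𝟙-nonNegative {true}  = _

𝟙≤1 : ∀ b → 𝟙 b ≤ + 1
𝟙≤1 false = +≤+ ℕ.z≤n
𝟙≤1 true  = ℤ.≤-refl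

pred[i+𝟙]≤i : ∀ i b → pred (i + 𝟙 b) ≤ i
pred[i+𝟙]≤i i false = ℤ.i≤j⇒pred[i]≤j (ℤ.≤-reflexive (ℤ.+-identityʳ i))
pred[i+𝟙]≤i i true  = ℤ.≤-reflexive (trans (sym (ℤ.+-pred i (+ 1))) (ℤ.+-identityʳ i))

𝟙-∨ : ∀ b c → 𝟙 (b ∨ c) ≡ 𝟙 b ⊔ 𝟙 c
𝟙-∨ false false = refl
𝟙-∨ false true  = refl
𝟙-∨ true  false = refl
𝟙-∨ true  true  = refl

⊔-+𝟙-≡ : ∀ {i j} b c → i ≡ j → (i + 𝟙 b) ⊔ (j + 𝟙 c) ≡ (i ⊔ j) + 𝟙 (b ∨ c)
⊔-+𝟙-≡ {i} b c refl = begin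
  (i + 𝟙 b) ⊔ (i + 𝟙 c) ≡⟨ ℤ.mono-<-distrib-⊔ (λ k → i + k) (ℤ.+-monoʳ-< i) (𝟙 b) (𝟙 c) ⟨
  i + (𝟙 b ⊔ 𝟙 c)       ≡⟨ cong (λ k → i + k) (𝟙-∨ b c) ⟨
  i + 𝟙 (b ∨ c)         ≡⟨ cong (_+ 𝟙 (b ∨ c)) (ℤ.⊔-idem i) ⟨
  (i ⊔ i) + 𝟙 (b ∨ c)   ∎
  where open ≡-Reasoning

-- A jump of at most 1 cannot overturn a strict inequality of integers.
⊔-+𝟙-< : ∀ {i j} b c → i < j → (i + 𝟙 b) ⊔ (j + 𝟙 c) ≡ (i ⊔ j) + 𝟙 c
⊔-+𝟙-< {i} {j} b c i<j = begin
  (i + 𝟙 b) ⊔ (j + 𝟙 c) ≡⟨ ℤ.i≤j⇒i⊔j≡j i+𝟙≤j+𝟙 ⟩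
  j + 𝟙 c               ≡⟨ cong (_+ 𝟙 c) (ℤ.i≤j⇒i⊔j≡j (ℤ.<⇒≤ i<j)) ⟨
  (i ⊔ j) + 𝟙 c         ∎
  where
  open ≡-Reasoning
  i+𝟙≤j+𝟙 : i + 𝟙 b ≤ j + 𝟙 c
  i+𝟙≤j+𝟙 = ℤ.≤-trans (ℤ.+-monoʳ-≤ i (𝟙≤1 b))
              (ℤ.≤-trans (ℤ.≤-reflexive (ℤ.+-comm i (+ 1)))
                (ℤ.≤-trans (ℤ.i<j⇒suc[i]≤j i<j) (ℤ.i≤i+j j (𝟙 c))))

⊔-+𝟙-> : ∀ {i j} b c → j < i → (i + 𝟙 b) ⊔ (j + 𝟙 c) ≡ (i ⊔ j) + 𝟙 b
⊔-+𝟙-> {i} {j} b c j<i = begin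
  (i + 𝟙 b) ⊔ (j + 𝟙 c) ≡⟨ ℤ.⊔-comm (i + 𝟙 b) (j + 𝟙 c) ⟩
  (j + 𝟙 c) ⊔ (i + 𝟙 b) ≡⟨ ⊔-+𝟙-< c b j<i ⟩
  (j ⊔ i) + 𝟙 b         ≡⟨ cong (_+ 𝟙 b) (ℤ.⊔-comm j i) ⟩
  (i ⊔ j) + 𝟙 b         ∎
  where open ≡-Reasoning

union-of-overlapping-intervals : ∀ {lo₁ hi₁ lo₂ hi₂} → pred lo₁ ≤ hi₂ → pred lo₂ ≤ hi₁ →
  ∀ c → (c ∈[ lo₁ , hi₁ ] ⊎ c ∈[ lo₂ , hi₂ ]) ⇔ c ∈[ lo₁ ⊓ lo₂ , hi₁ ⊔ hi₂ ]
union-of-overlapping-intervals {lo₁} {hi₁} {lo₂} {hi₂} pred[lo₁]≤hi₂ pred[lo₂]≤hi₁ c = mk⇔ to from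
  where
  to : c ∈[ lo₁ , hi₁ ] ⊎ c ∈[ lo₂ , hi₂ ] → c ∈[ lo₁ ⊓ lo₂ , hi₁ ⊔ hi₂ ]
  to (inj₁ (lo₁≤c , c≤hi₁)) = ℤ.i≤j⇒i⊓k≤j lo₂ lo₁≤c , ℤ.i≤j⇒i≤j⊔k hi₂ c≤hi₁
  to (inj₂ (lo₂≤c , c≤hi₂)) = ℤ.i≤j⇒k⊓i≤j lo₁ lo₂≤c , ℤ.i≤j⇒i≤k⊔j hi₁ c≤hi₂

  from : c ∈[ lo₁ ⊓ lo₂ , hi₁ ⊔ hi₂ ] → c ∈[ lo₁ , hi₁ ] ⊎ c ∈[ lo₂ , hi₂ ]
  from (lo≤c , c≤hi) with lo₁ ≤? c | c ≤? hi₁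
  ... | yes lo₁≤c | yes c≤hi₁ = inj₁ (lo₁≤c , c≤hi₁)
  ... | no lo₁≰c  | _         = inj₂ (lo₂≤c , c≤hi₂)
    where
    c<lo₁ : c < lo₁
    c<lo₁ = ℤ.≰⇒> lo₁≰c
    lo₂≤c : lo₂ ≤ c
    lo₂≤c with ℤ.⊓-sel lo₁ lo₂
    ... | inj₁ lo≡lo₁ = contradiction (subst₂ _≤_ lo≡lo₁ refl lo≤c) lo₁≰c
    ... | inj₂ lo≡lo₂ = subst₂ _≤_ lo≡lo₂ refl lo≤c
    c≤hi₂ : c ≤ hi₂
    c≤hi₂ = ℤ.≤-trans (ℤ.i<j⇒i≤pred[j] c<lo₁) pred[lo₁]≤hi₂
  ... | yes _     | no c≰hi₁  = inj₂ (lo₂≤c , c≤hi₂)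
    where
    hi₁<c : hi₁ < c
    hi₁<c = ℤ.≰⇒> c≰hi₁
    c≤hi₂ : c ≤ hi₂
    c≤hi₂ with ℤ.⊔-sel hi₁ hi₂
    ... | inj₁ hi≡hi₁ = contradiction (subst₂ _≤_ refl hi≡hi₁ c≤hi) c≰hi₁
    ... | inj₂ hi≡hi₂ = subst₂ _≤_ refl hi≡hi₂ c≤hi
    lo₂≤c : lo₂ ≤ c
    lo₂≤c = subst₂ _≤_ (ℤ.suc-pred lo₂) refl
              (ℤ.i<j⇒suc[i]≤j (ℤ.≤-<-trans pred[lo₂]≤hi₁ hi₁<c))

⊔-into-u : ∀ {ℓ} (G : Digraph (Fin ℓ)) (n : Fin ℓ → ℕ) (s t : Fin ℓ) (w : ℕ)
  (i : Fin ℓ) (i≢s : i ≢ s) (i≢t : i ≢ t) →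
  let i' = old i i≢s i≢t in
  (+ n i - + w + ε G i s) ⊔ (+ n i + ε G i t) ≡ + contractN n s t w i' + ε (contract G n s t w) i' u
⊔-into-u G n s t ℕ.zero i _ _ = begin
  (+ n i + + 0 + ε G i s) ⊔ (+ n i + ε G i t) ≡⟨ ⊔-+𝟙-≡ (edge G i s) (edge G i t) n+0≡n ⟩
  (+ n i + + 0 ⊔ + n i) + 𝟙 e                 ≡⟨ cong (_+ 𝟙 e) (ℤ.i≤j⇒i⊔j≡j (ℤ.≤-reflexive n+0≡n)) ⟩
  + n i + 𝟙 e                                 ∎
  where
  open ≡-Reasoning
  e : Bool
  e = edge G i s ∨ edge G i t
  n+0≡n : + n i + + 0 ≡ + n i
  n+0≡n = ℤ.+-identityʳ (+ n i)
⊔-into-u G n s t (ℕ.suc k) i _ _ = begin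
  (+ n i - + ℕ.suc k + ε G i s) ⊔ (+ n i + ε G i t) ≡⟨ ⊔-+𝟙-< (edge G i s) (edge G i t) n-1-k<n ⟩
  (+ n i - + ℕ.suc k ⊔ + n i) + ε G i t             ≡⟨ cong (_+ ε G i t) (ℤ.i≤j⇒i⊔j≡j (ℤ.<⇒≤ n-1-k<n)) ⟩
  + n i + ε G i t                                   ∎
  where
  open ≡-Reasoning
  n-1-k<n : + n i - + ℕ.suc k < + n i
  n-1-k<n = ℤ.m⊖1+n<m (n i) (ℕ.suc k)

⊔-out-of-u : ∀ {ℓ} (G : Digraph (Fin ℓ)) (n : Fin ℓ → ℕ) (s t : Fin ℓ) (w : ℕ)
  (i : Fin ℓ) (i≢s : i ≢ s) (i≢t : i ≢ t) →
  let i' = old i i≢s i≢t in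
  (+ n s + + w + ε G s i) ⊔ (+ n t + ε G t i) ≡ + contractN n s t w u + ε (contract G n s t w) u i'
⊔-out-of-u G n s t w i _ _ with ℕ.<-cmp (n s ℕ.+ w) (n t)
... | tri< ns+w<nt _ _ = ⊔-+𝟙-< (edge G s i) (edge G t i) (+<+ ns+w<nt)
... | tri≈ _ ns+w≡nt _ = ⊔-+𝟙-≡ (edge G s i) (edge G t i) (cong +_ ns+w≡nt)
... | tri> _ _ nt<ns+w = ⊔-+𝟙-> (edge G s i) (edge G t i) (+<+ nt<ns+w)

pred[-a+w-𝟙]≤m+𝟙 : ∀ a w m b c d → + w ≤ + m + 𝟙 d → pred (- + a + + w - 𝟙 b) ≤ + m + 𝟙 c
pred[-a+w-𝟙]≤m+𝟙 a w m b c d w≤m+𝟙 = begin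
  pred (- + a + + w - 𝟙 b) ≤⟨ ℤ.pred-mono -a+w-𝟙≤w ⟩
  pred (+ w)               ≤⟨ ℤ.pred-mono w≤m+𝟙 ⟩
  pred (+ m + 𝟙 d)         ≤⟨ pred[i+𝟙]≤i (+ m) d ⟩
  + m                      ≤⟨ ℤ.i≤i+j (+ m) (𝟙 c) ⟩
  + m + 𝟙 c                ∎
  where
  open ℤ.≤-Reasoning
  -a+w-𝟙≤w : - + a + + w - 𝟙 b ≤ + w
  -a+w-𝟙≤w = ℤ.≤-trans (ℤ.i-j≤i (- + a + + w) (𝟙 b))
                       (ℤ.+-monoˡ-≤ (+ w) (ℤ.neg-≤-pos {a} {0}))

pred[-a-𝟙]≤m+𝟙 : ∀ a m b c → pred (- + a - 𝟙 b) ≤ + m + 𝟙 c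
pred[-a-𝟙]≤m+𝟙 a m b c = begin
  pred (- + a - 𝟙 b) ≤⟨ ℤ.i≤j⇒pred[i]≤j ℤ.≤-refl ⟩
  - + a - 𝟙 b        ≤⟨ ℤ.i-j≤i (- + a) (𝟙 b) ⟩
  - + a              ≤⟨ ℤ.neg-≤-pos ⟩
  + m                ≤⟨ ℤ.i≤i+j (+ m) (𝟙 c) ⟩
  + m + 𝟙 c          ∎
  where open ℤ.≤-Reasoning

⊔≡⇒neg-⊓≡neg : ∀ a w e₁ e₂ x y → (a - w + e₁) ⊔ (a + e₂) ≡ x + y →
  (- a + w - e₁) ⊓ (- a - e₂) ≡ - x - y
⊔≡⇒neg-⊓≡neg a w e₁ e₂ x y ⊔≡x+y = begin
  (- a + w - e₁) ⊓ (- a - e₂)     ≡⟨ cong₂ _⊓_ neg[a-w+e₁] (ℤ.neg-distrib-+ a e₂) ⟨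
  - (a - w + e₁) ⊓ - (a + e₂)     ≡⟨ ℤ.neg-distrib-⊔-⊓ (a - w + e₁) (a + e₂) ⟨
  - ((a - w + e₁) ⊔ (a + e₂))     ≡⟨ cong -_ ⊔≡x+y ⟩
  - (x + y)                       ≡⟨ ℤ.neg-distrib-+ x y ⟩
  - x - y                         ∎
  where
  open ≡-Reasoning
  neg[a-w+e₁] : - (a - w + e₁) ≡ - a + w - e₁
  neg[a-w+e₁] = trans (ℤ.neg-distrib-+ (a - w) e₁)
    (cong (_- e₁) (trans (ℤ.neg-distrib-+ a (- w)) (cong (λ k → - a + k) (ℤ.neg-involutive w))))

lemma2p4 : (ℓ : ℕ) → ℓ ≥ 2 → (G : Digraph (Fin ℓ)) → (n : Fin ℓ → ℕ) →
    (s t : Fin ℓ) → s ≢ t → (w : ℕ) → + w ℤ.≤ + n t + ε G t s →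
    let GH = contract G n s t w
        nH = contractN n s t w
    in (i : Fin ℓ) → (i≢s : i ≢ s) → (i≢t : i ≢ t) →
    let i' = old i i≢s i≢t
    in ((+ n i - + w + ε G i s) ⊔ (+ n i + ε G i t) ≡ + nH i' + ε GH i' u)
       × ((+ n s + + w + ε G s i) ⊔ (+ n t + ε G t i) ≡ + nH u + ε GH u i')
       × ((c : ℤ) →
            ((c ∈[ - + n i + + w - ε G i s , + n s + + w + ε G s i ])
               ⊎ (c ∈[ - + n i - ε G i t , + n t + ε G t i ]))
            ⇔ (c ∈[ - + nH i' - ε GH i' u , + nH u + ε GH u i' ]))
lemma2p4 _ _ G n s t _ w w≤nt+ε i i≢s i≢t = into-u , out-of-u , union
  where
  GH : Digraph (VH s t)
  GH = contract G n s t w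
  nH : VH s t → ℕ
  nH = contractN n s t w
  i' : VH s t
  i' = old i i≢s i≢t

  into-u : (+ n i - + w + ε G i s) ⊔ (+ n i + ε G i t) ≡ + nH i' + ε GH i' u
  into-u = ⊔-into-u G n s t w i i≢s i≢t
  out-of-u : (+ n s + + w + ε G s i) ⊔ (+ n t + ε G t i) ≡ + nH u + ε GH u i'
  out-of-u = ⊔-out-of-u G n s t w i i≢s i≢t

  union : ∀ c → (c ∈[ - + n i + + w - ε G i s , + n s + + w + ε G s i ]
                   ⊎ c ∈[ - + n i - ε G i t , + n t + ε G t i ])
                ⇔ c ∈[ - + nH i' - ε GH i' u , + nH u + ε GH u i' ]
  union c = subst₂ (λ lo hi → _ ⇔ c ∈[ lo , hi ])
    (⊔≡⇒neg-⊓≡neg (+ n i) (+ w) (ε G i s) (ε G i t) (+ nH i') (ε GH i' u) into-u)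
    out-of-u
    (union-of-overlapping-intervals
      (pred[-a+w-𝟙]≤m+𝟙 (n i) w (n t) (edge G i s) (edge G t i) (edge G t s) w≤nt+ε)
      (pred[-a-𝟙]≤m+𝟙 (n i) (n s ℕ.+ w) (edge G i t) (edge G s i))
      c)
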